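{- Let $n \geq 2$ be an integer. Then \[ \sum_{\substack{k \in \mathbb{Z} \\ k > \sqrt{n}}} \Delta_n(k) < \sqrt{n}, \] where the sum has only finitely many nonzero terms.
   Context: For an integer $n \geq 2$ and real $x > \sqrt{n}$ define $\phi_n(x) := \lfloor \frac{n-1}{x-1} \rfloor$, $\psi_n(x) := \lfloor \frac{n}{x} \rfloor$, and $\Delta_n(x) := \phi_n(x) - \psi_n(x)$, where $\lfloor \cdot \rfloor$ is the integer part. (Note $\Delta_n(x) = 0$ for $x \geq n$.) -}

module Defs where

open import Data.Nat as ℕ using (ℕ; zero; suc; _∸_; _<?_)
open import Data.Nat.DivMod using (_/_)
open import Data.Integer using (ℤ; +_; _-_; _+_; _*_; _<_)
open import Data.Sum using (_⊎_)
open import Relation.Nullary using (yes; no)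

-- φ_n(k) = ⌊(n-1)/(k-1)⌋ for an integer k ≥ 2 (value 0 for k < 2 is junk,
-- never used: k > √n ≥ √2 forces k ≥ 2).  For k ≥ 2 and n ≥ 1 both operands are
-- nonnegative, so the floor is natural-number division.
φ : ℕ → ℕ → ℕ
φ n (suc (suc j)) = (n ∸ 1) / suc j
φ n _ = 0

-- ψ_n(k) = ⌊n/k⌋ (junk 0 for k = 0, never used).
ψ : ℕ → ℕ → ℕ
ψ n (suc j) = n / suc j
ψ n zero = 0

Δ : ℕ → ℕ → ℤ
Δ n k = (+ φ n k) - (+ ψ n k)

-- Σ_{k < N, k > √n} Δ_n(k); for a natural k, k > √n ⇔ n < k*k.
ΔSum : ℕ → ℕ → ℤ
ΔSum n zero = + 0
ΔSum n (suc k) with n <? k ℕ.* k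
... | yes _ = ΔSum n k + Δ n k
... | no _  = ΔSum n k

_<√_ : ℤ → ℕ → Set
x <√ n = x < + 0 ⊎ x * x < + n

module Submission where

-- Let a = ⌊√n⌋ ≥ 1, so a² ≤ n < (a+1)².  The indices k > √n are exactly
-- a+1 ≤ k, and Δ_n(k) = 0 once k > n, so the sum in question is
-- Σ_{k=a+1}^{n} (φ_n(k) - ψ_n(k)).  Since φ_n(k+1) = ⌊(n-1)/k⌋ ≤ ⌊n/k⌋ = ψ_n(k),
-- the sum telescopes into an inequality: the quantity
--     S⁺ n N = Σ_{√n<k≤N} Δ_n(k) + ψ_n(N)
-- is non-increasing in N for N ≥ a+1, and equals φ_n(a+1) at N = a+1.
-- Taking N = n (where ψ_n(n) = 1) gives  Σ + 1 ≤ ⌊(n-1)/a⌋.  Finally, if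
-- s+1 ≤ ⌊(n-1)/a⌋ then (s+1)a < n < (a+1)², which forces s ≤ a and hence
-- s² ≤ sa < (s+1)a < n, i.e. s < √n.

open import Defs
open import Data.Nat using (ℕ; _≤_; _<_; _*_; suc)
open import Data.Integer using (+_)
open import Data.Product using (_×_; ∃; _,_)
open import Relation.Binary.PropositionalEquality using (_≡_)

open import Data.Nat as ℕ using (zero; _∸_; _<?_; _≤′_; z≤n; s≤s)
import Data.Nat.Properties as ℕP
open import Data.Nat.DivMod using (_/_; m<n⇒m/n≡0; m/n*n≤m; /-monoˡ-≤; n/n≡1)
open import Data.Nat.Solver using (module +-*-Solver)
open import Data.Integer as ℤ using (ℤ; -[1+_]; +≤+; +<+; -<+)
import Data.Integer.Properties as ℤP
open import Data.Integer.Solver as ℤSolver using ()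
open import Data.Sum using (inj₁; inj₂)
open import Relation.Nullary using (yes; no; ¬_)
open import Relation.Nullary.Negation using (contradiction)
open import Relation.Binary.PropositionalEquality using (refl; sym; cong; subst; module ≡-Reasoning)

integerSqrt : ∀ n → ∃ λ a → a * a ≤ n × n < suc a * suc a
integerSqrt zero = 0 , z≤n , s≤s z≤n
integerSqrt (suc n) with integerSqrt n
... | a , lo , hi with suc n <? suc a * suc a
...   | yes below = a , ℕP.m≤n⇒m≤1+n lo , below
...   | no notBelow = suc a , ℕP.≤-reflexive (sym square) , next
  where
  square : suc n ≡ suc a * suc a
  square = ℕP.≤-antisym hi (ℕP.≮⇒≥ notBelow)
  next : suc n < suc (suc a) * suc (suc a)
  next = subst (_< suc (suc a) * suc (suc a)) (sym square)
           (ℕP.*-mono-< (ℕP.n<1+n (suc a)) (ℕP.n<1+n (suc a)))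

suc-root≤ : ∀ {n a} → 2 ≤ n → a * a ≤ n → suc a ≤ n
suc-root≤ {a = zero} two≤n _ = ℕP.≤-trans (s≤s z≤n) two≤n
suc-root≤ {a = suc zero} two≤n _ = two≤n
suc-root≤ {a = suc (suc c)} _ a²≤n = ℕP.≤-trans (ℕP.m<m+n (suc (suc c)) (s≤s z≤n)) a²≤n

square-expansion : ∀ a → suc (suc (suc a) * a) ≡ suc a * suc a
square-expansion = solve 1 (λ a → con 1 :+ (con 2 :+ a) :* a := (con 1 :+ a) :* (con 1 :+ a)) refl
  where open +-*-Solver

cofactor≤ : ∀ a s → suc (suc s * a) < suc a * suc a → s ≤ a
cofactor≤ a s small = ℕP.≮⇒≥ λ a<s →
  ℕP.<-irrefl refl (ℕP.<-≤-trans small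
    (subst (_≤ suc (suc s * a)) (square-expansion a) (s≤s (ℕP.*-monoˡ-≤ a (s≤s a<s)))))

quotient-below-root : ∀ n b s → 1 ≤ n → n < suc (suc b) * suc (suc b) →
                      suc s ≤ (n ∸ 1) / suc b → s * s < n
quotient-below-root (suc n) b s _ n<root² s+1≤q = begin-strict
  s * s          ≤⟨ ℕP.*-monoʳ-≤ s (cofactor≤ (suc b) s (ℕP.<-≤-trans (s≤s (s≤s product≤n)) n<root²)) ⟩
  s * suc b      <⟨ ℕP.m<n+m (s * suc b) (s≤s z≤n) ⟩
  suc s * suc b  ≤⟨ product≤n ⟩
  n              <⟨ ℕP.n<1+n n ⟩
  suc n          ∎
  where
  open ℕP.≤-Reasoning
  product≤n : suc s * suc b ≤ n
  product≤n = ℕP.≤-trans (ℕP.*-monoˡ-≤ (suc b) s+1≤q) (m/n*n≤m n (suc b))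

<√-from-bound : ∀ n q S → (∀ s → suc s ≤ q → s * s < n) → S ℤ.+ + 1 ℤ.≤ + q → S <√ n
<√-from-bound n q -[1+ _ ] _ _ = inj₁ -<+
<√-from-bound n q (+ s) bound (+≤+ s+1≤q) =
  inj₂ (subst (ℤ._< + n) (ℤP.pos-* s s) (+<+ (bound s (subst (_≤ q) (ℕP.+-comm s 1) s+1≤q))))

Δ-vanishes : ∀ n k → n < k → Δ n k ≡ + 0
Δ-vanishes zero (suc zero) _ = refl
Δ-vanishes (suc n) (suc zero) (s≤s ())
Δ-vanishes n (suc (suc j)) n<k
  rewrite m<n⇒m/n≡0 {n ∸ 1} {suc j} (s≤s (ℕP.∸-monoˡ-≤ 1 (ℕP.≤-pred n<k)))
        | m<n⇒m/n≡0 {n} {suc (suc j)} n<k = refl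

-- φ_n(k+1) = ⌊(n-1)/k⌋ ≤ ⌊n/k⌋ = ψ_n(k): the inequality that makes the sum telescope.
φ-suc≤ψ : ∀ n j → φ n (suc (suc j)) ≤ ψ n (suc j)
φ-suc≤ψ n j = /-monoˡ-≤ (suc j) (ℕP.m∸n≤m n 1)

ψ-self : ∀ n → 1 ≤ n → ψ n n ≡ 1
ψ-self (suc m) _ = n/n≡1 (suc m)

ΔSum-include : ∀ n k → n < k * k → ΔSum n (suc k) ≡ ΔSum n k ℤ.+ Δ n k
ΔSum-include n k above with n <? k * k
... | yes _ = refl
... | no notAbove = contradiction above notAbove

ΔSum-exclude : ∀ n k → ¬ n < k * k → ΔSum n (suc k) ≡ ΔSum n k
ΔSum-exclude n k notAbove with n <? k * k
... | yes above = contradiction above notAbove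
... | no _ = refl

ΔSum-below-root : ∀ n a M → a * a ≤ n → M ≤ suc a → ΔSum n M ≡ + 0
ΔSum-below-root n a zero _ _ = refl
ΔSum-below-root n a (suc k) a²≤n (s≤s k≤a) = begin
  ΔSum n (suc k)  ≡⟨ ΔSum-exclude n k (ℕP.≤⇒≯ (ℕP.≤-trans (ℕP.*-mono-≤ k≤a k≤a) a²≤n)) ⟩
  ΔSum n k        ≡⟨ ΔSum-below-root n a k a²≤n (ℕP.m≤n⇒m≤1+n k≤a) ⟩
  + 0             ∎
  where open ≡-Reasoning

-- Partial sum over √n < k ≤ N, corrected by the boundary term ψ_n(N).
S⁺ : ℕ → ℕ → ℤ
S⁺ n N = ΔSum n (suc N) ℤ.+ + ψ n N

cancel-ψ : ∀ (s x y : ℤ) → (s ℤ.+ (x ℤ.- y)) ℤ.+ y ≡ s ℤ.+ x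
cancel-ψ = solve 3 (λ s x y → (s :+ (x :- y)) :+ y := s :+ x) refl
  where open ℤSolver.+-*-Solver

S⁺-above-root : ∀ n k → n < k * k → S⁺ n k ≡ ΔSum n k ℤ.+ + φ n k
S⁺-above-root n k above = begin
  S⁺ n k                                  ≡⟨ cong (ℤ._+ + ψ n k) (ΔSum-include n k above) ⟩
  (ΔSum n k ℤ.+ Δ n k) ℤ.+ + ψ n k        ≡⟨ cancel-ψ (ΔSum n k) (+ φ n k) (+ ψ n k) ⟩
  ΔSum n k ℤ.+ + φ n k                    ∎
  where open ≡-Reasoning

S⁺-antitone : ∀ n j → n < suc (suc j) * suc (suc j) → S⁺ n (suc (suc j)) ℤ.≤ S⁺ n (suc j)
S⁺-antitone n j above = begin
  S⁺ n (suc (suc j))                            ≡⟨ S⁺-above-root n (suc (suc j)) above ⟩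
  ΔSum n (suc (suc j)) ℤ.+ + φ n (suc (suc j))  ≤⟨ ℤP.+-monoʳ-≤ (ΔSum n (suc (suc j))) (+≤+ (φ-suc≤ψ n j)) ⟩
  S⁺ n (suc j)                                  ∎
  where open ℤP.≤-Reasoning

S⁺-at-root : ∀ n a → a * a ≤ n → n < suc a * suc a → S⁺ n (suc a) ≡ + φ n (suc a)
S⁺-at-root n a a²≤n above = begin
  S⁺ n (suc a)                      ≡⟨ S⁺-above-root n (suc a) above ⟩
  ΔSum n (suc a) ℤ.+ + φ n (suc a)  ≡⟨ cong (ℤ._+ + φ n (suc a)) (ΔSum-below-root n a (suc a) a²≤n ℕP.≤-refl) ⟩
  + φ n (suc a)                     ∎
  where open ≡-Reasoning

antitone-from : ∀ (f : ℕ → ℤ) m → (∀ N → m ≤ N → f (suc N) ℤ.≤ f N) → ∀ {N} → m ≤′ N → f N ℤ.≤ f m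
antitone-from f m step ℕ.≤′-refl = ℤP.≤-refl
antitone-from f m step (ℕ.≤′-step m≤′N) = ℤP.≤-trans (step _ (ℕP.≤′⇒≤ m≤′N)) (antitone-from f m step m≤′N)

telescoped-bound : ∀ n b N → suc b * suc b ≤ n → n < suc (suc b) * suc (suc b) →
                   suc (suc b) ≤ N → S⁺ n N ℤ.≤ + ((n ∸ 1) / suc b)
telescoped-bound n b N a²≤n above a+1≤N =
  subst (S⁺ n N ℤ.≤_) (S⁺-at-root n (suc b) a²≤n above)
    (antitone-from (S⁺ n) (suc (suc b)) step (ℕP.≤⇒≤′ a+1≤N))
  where
  step : ∀ M → suc (suc b) ≤ M → S⁺ n (suc M) ℤ.≤ S⁺ n M
  step (suc j) a+1≤M = S⁺-antitone n j
    (ℕP.<-≤-trans above (ℕP.*-mono-≤ (ℕP.m≤n⇒m≤1+n a+1≤M) (ℕP.m≤n⇒m≤1+n a+1≤M)))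

lemma7 : (n : ℕ) → 2 ≤ n →
    ((k : ℕ) → n < k → Δ n k ≡ + 0) × (ΔSum n (suc n) <√ n)
lemma7 n two≤n = Δ-vanishes n , sum<√n (integerSqrt n)
  where
  sum<√n : (∃ λ a → a * a ≤ n × n < suc a * suc a) → ΔSum n (suc n) <√ n
  sum<√n (zero , _ , n<1) = contradiction (ℕP.≤-trans two≤n (ℕP.≤-pred n<1)) λ ()
  sum<√n (suc b , a²≤n , above) =
    <√-from-bound n ((n ∸ 1) / suc b) (ΔSum n (suc n))
      (λ s → quotient-below-root n b s one≤n above)
      (subst (λ t → ΔSum n (suc n) ℤ.+ + t ℤ.≤ + ((n ∸ 1) / suc b)) (ψ-self n one≤n)
        (telescoped-bound n b n a²≤n above (suc-root≤ two≤n a²≤n)))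
    where
    one≤n : 1 ≤ n
    one≤n = ℕP.≤-trans (s≤s z≤n) two≤n
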